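{- Let $(P,\leq)$ be a poset, $f \in \operatorname{Aut}(P)$ and $x,y \in P$. (a) The following are equivalent: (i) $\mathcal{O}_f(x) <_f^s \mathcal{O}_f(y)$; (ii) $f^n(x) < y$ for every $n \in \mathbb{Z}$; (iii) $x < f^n(y)$ for every $n \in \mathbb{Z}$; (iv) $b_i^f(x,y)$ holds for every $i \in \mathbb{Z}$, and $x \neq y$. (b) The following are equivalent: (i) $\mathcal{O}_f(x) \leq_f^w \mathcal{O}_f(y)$; (ii) $f^n(x) \leq y$ for some $n \in \mathbb{Z}$; (iii) $x \leq f^n(y)$ for some $n \in \mathbb{Z}$; (iv) $b_i^f(x,y)$ holds for some $i \in \mathbb{Z}$.
   Context: For a poset $P$ and $f\in\operatorname{Aut}(P)$: $x\sim_f y$ iff $f^i(x)\le y\le f^j(x)$ for some $i,j\in\mathbb{Z}$ (an equivalence relation), with class $\mathcal{O}_f(x)$. Strong order: $\mathcal{O}_f(x) <_f^s \mathcal{O}_f(y)$ iff $x'<y'$ for all $x'\sim_f x$, $y'\sim_f y$. Weak order: $\mathcal{O}_f(x) \leq_f^w \mathcal{O}_f(y)$ iff $x'\le y'$ for some $x'\sim_f x$, $y'\sim_f y$. $b_i^f(x,y)$ means $x \le f^i(y)$. -}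

module Defs where

open import Level using (Level; _⊔_)
open import Data.Nat using (ℕ; zero; suc)
open import Data.Integer using (ℤ; +_; -[1+_])
open import Data.Product using (Σ; ∃; _×_; _,_)
open import Relation.Nullary using (¬_)
open import Relation.Binary.Bundles using (Poset)

module _ {c ℓ₁ ℓ₂ : Level} (P : Poset c ℓ₁ ℓ₂) where
  open Poset P using (_≈_; _≤_) renaming (Carrier to A)

  _<_ : A → A → Set (ℓ₁ ⊔ ℓ₂)
  x < y = (x ≤ y) × ¬ (x ≈ y)

  record Aut : Set (c ⊔ ℓ₁ ⊔ ℓ₂) where
    field
      fun      : A → A
      inv      : A → A
      fun-mono : ∀ {x y} → x ≤ y → fun x ≤ fun y
      inv-mono : ∀ {x y} → x ≤ y → inv x ≤ inv y
      fun-cong : ∀ {x y} → x ≈ y → fun x ≈ fun y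
      inv-cong : ∀ {x y} → x ≈ y → inv x ≈ inv y
      inv-fun  : ∀ x → inv (fun x) ≈ x
      fun-inv  : ∀ x → fun (inv x) ≈ x

  module _ (f : Aut) where
    open Aut f

    iterℕ : (A → A) → ℕ → A → A
    iterℕ g zero    x = x
    iterℕ g (suc n) x = g (iterℕ g n x)

    pow : ℤ → A → A
    pow (+ n)      x = iterℕ fun n x
    pow -[1+ n ]   x = iterℕ inv (suc n) x

    _∼f_ : A → A → Set ℓ₂
    x ∼f y = Σ ℤ λ i → Σ ℤ λ j → (pow i x ≤ y) × (y ≤ pow j x)

    -- strong order on classes, stated on representatives:
    -- O_f(x) <ˢ O_f(y) iff x' < y' for all x' ∼ x, y' ∼ y
    _<ˢ_ : A → A → Set (c ⊔ ℓ₁ ⊔ ℓ₂)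
    x <ˢ y = ∀ x' y' → x ∼f x' → y ∼f y' → x' < y'

    -- weak order: O_f(x) ≤ʷ O_f(y) iff x' ≤ y' for some x' ∼ x, y' ∼ y
    _≤ʷ_ : A → A → Set (c ⊔ ℓ₂)
    x ≤ʷ y = Σ A λ x' → Σ A λ y' → (x ∼f x') × (y ∼f y') × (x' ≤ y')

    b : ℤ → A → A → Set ℓ₂
    b i x y = x ≤ pow i y

-- Each power f^n is an order isomorphism with inverse f^(-n), so powers can be moved across
-- any comparison: f^n a ≤ b ⇔ a ≤ f^(-n) b, and likewise for ≈ and <.  Since the class of x
-- is sandwiched between powers of x, all four descriptions of each order then reduce to
-- statements about f^n x and y.
module Submission where

open import Defs
open import Level using (Level)
open import Data.Integer using (ℤ)
open import Data.Product using (Σ; _×_)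
open import Function.Bundles using (_⇔_)
open import Relation.Nullary using (¬_)
open import Relation.Binary.Bundles using (Poset)

open import Data.Nat using (zero; suc)
open import Data.Integer using (+_; -[1+_]; _+_; -_; pred) renaming (suc to sucℤ)
open import Data.Integer.Properties using (+-identityˡ; suc-+; pred-+; +-inverseˡ; +-inverseʳ)
open import Data.Product using (_,_; proj₁; proj₂; map)
open import Function.Base using (_∘_)
open import Function.Bundles using (mk⇔; module Equivalence)
open import Function.Properties.Equivalence using () renaming (trans to ⇔-trans)
open import Relation.Binary.Core using (Rel; _Preserves_⟶_)
open import Relation.Binary.PropositionalEquality using (_≡_; cong; sym)
import Relation.Binary.Properties.Poset as PosetProperties
import Relation.Binary.Reasoning.PartialOrder as PartialOrderReasoning
import Relation.Binary.Reasoning.Setoid as SetoidReasoning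

open Equivalence using (to; from)

module _ {c ℓ₁ ℓ₂ : Level} (P : Poset c ℓ₁ ℓ₂) where
  open Poset P renaming (Carrier to A)
  open PosetProperties P using (mono⇒cong)

  module Transpose {g h : A → A}
    (g-mono : g Preserves _≤_ ⟶ _≤_) (h-mono : h Preserves _≤_ ⟶ _≤_)
    (h∘g : ∀ a → h (g a) ≈ a) (g∘h : ∀ b → g (h b) ≈ b) where

    ≤-transpose : ∀ {a b} → g a ≤ b ⇔ a ≤ h b
    ≤-transpose = mk⇔
      (λ ga≤b → trans (reflexive (Eq.sym (h∘g _))) (h-mono ga≤b))
      (λ a≤hb → trans (g-mono a≤hb) (reflexive (g∘h _)))

    ≈-transpose : ∀ {a b} → g a ≈ b ⇔ a ≈ h b
    ≈-transpose = mk⇔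
      (λ ga≈b → Eq.trans (Eq.sym (h∘g _)) (mono⇒cong h-mono ga≈b))
      (λ a≈hb → Eq.trans (mono⇒cong g-mono a≈hb) (g∘h _))

    <-transpose : ∀ {a b} → _<_ P (g a) b ⇔ _<_ P a (h b)
    <-transpose = mk⇔
      (map (to ≤-transpose) (_∘ from ≈-transpose))
      (map (from ≤-transpose) (_∘ to ≈-transpose))

  module Powers (f : Aut P) where
    open Aut f

    iterℕ-preserves : ∀ {ℓ} {_R_ : Rel A ℓ} {g : A → A} →
                      g Preserves _R_ ⟶ _R_ → ∀ n → iterℕ P f g n Preserves _R_ ⟶ _R_
    iterℕ-preserves g-pres zero    aRb = aRb
    iterℕ-preserves {_R_ = _R_} g-pres (suc n) aRb = g-pres (iterℕ-preserves {_R_ = _R_} g-pres n aRb)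

    pow-mono : ∀ n → pow P f n Preserves _≤_ ⟶ _≤_
    pow-mono (+ n)      = iterℕ-preserves {_R_ = _≤_} fun-mono n
    pow-mono -[1+ n ]   = iterℕ-preserves {_R_ = _≤_} inv-mono (suc n)

    pow-cong-index : ∀ {i j} a → i ≡ j → pow P f i a ≈ pow P f j a
    pow-cong-index a i≡j = Eq.reflexive (cong (λ k → pow P f k a) i≡j)

    fun∘pow : ∀ n a → fun (pow P f n a) ≈ pow P f (sucℤ n) a
    fun∘pow (+ n)          a = Eq.refl
    fun∘pow -[1+ zero ]    a = fun-inv a
    fun∘pow -[1+ suc n ]   a = fun-inv _

    inv∘pow : ∀ n a → inv (pow P f n a) ≈ pow P f (pred n) a
    inv∘pow (+ zero)    a = Eq.refl
    inv∘pow (+ suc n)   a = inv-fun _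
    inv∘pow -[1+ n ]    a = Eq.refl

    pow-+ : ∀ m n a → pow P f m (pow P f n a) ≈ pow P f (m + n) a
    pow-+ (+ zero)      n a = pow-cong-index a (sym (+-identityˡ n))
    pow-+ (+ suc m)     n a = begin
      fun (pow P f (+ m) (pow P f n a))  ≈⟨ fun-cong (pow-+ (+ m) n a) ⟩
      fun (pow P f (+ m + n) a)          ≈⟨ fun∘pow (+ m + n) a ⟩
      pow P f (sucℤ (+ m + n)) a         ≈⟨ pow-cong-index a (sym (suc-+ m n)) ⟩
      pow P f (+ suc m + n) a            ∎
      where open SetoidReasoning Eq.setoid
    pow-+ -[1+ zero ]   n a = inv∘pow n a
    pow-+ -[1+ suc m ]  n a = begin
      inv (pow P f -[1+ m ] (pow P f n a))  ≈⟨ inv-cong (pow-+ -[1+ m ] n a) ⟩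
      inv (pow P f (-[1+ m ] + n) a)        ≈⟨ inv∘pow (-[1+ m ] + n) a ⟩
      pow P f (pred (-[1+ m ] + n)) a       ≈⟨ pow-cong-index a (sym (pred-+ -[1+ m ] n)) ⟩
      pow P f (-[1+ suc m ] + n) a          ∎
      where open SetoidReasoning Eq.setoid

    pow-inverseˡ : ∀ n a → pow P f (- n) (pow P f n a) ≈ a
    pow-inverseˡ n a = Eq.trans (pow-+ (- n) n a) (pow-cong-index a (+-inverseˡ n))

    pow-inverseʳ : ∀ n a → pow P f n (pow P f (- n) a) ≈ a
    pow-inverseʳ n a = Eq.trans (pow-+ n (- n) a) (pow-cong-index a (+-inverseʳ n))

    module PowTranspose n =
      Transpose (pow-mono n) (pow-mono (- n)) (pow-inverseˡ n) (pow-inverseʳ n)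
    module NegPowTranspose n =
      Transpose (pow-mono (- n)) (pow-mono n) (pow-inverseʳ n) (pow-inverseˡ n)

    inv-fixed : ∀ {z} → fun z ≈ z → inv z ≈ z
    inv-fixed {z} fz≈z = Eq.trans (inv-cong (Eq.sym fz≈z)) (inv-fun z)

    iterℕ-fixed : ∀ {g : A → A} {z} → g Preserves _≈_ ⟶ _≈_ → g z ≈ z →
                  ∀ n → iterℕ P f g n z ≈ z
    iterℕ-fixed g-cong gz≈z zero    = Eq.refl
    iterℕ-fixed g-cong gz≈z (suc n) = Eq.trans (g-cong (iterℕ-fixed g-cong gz≈z n)) gz≈z

    pow-fixed : ∀ {z} → fun z ≈ z → ∀ n → pow P f n z ≈ z
    pow-fixed fz≈z (+ n)    = iterℕ-fixed fun-cong fz≈z n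
    pow-fixed fz≈z -[1+ n ] = iterℕ-fixed inv-cong (inv-fixed fz≈z) (suc n)

    ≤fun∧≤inv⇒fixed : ∀ {z} → z ≤ fun z → z ≤ inv z → fun z ≈ z
    ≤fun∧≤inv⇒fixed {z} z≤fz z≤f⁻¹z =
      antisym (trans (fun-mono z≤f⁻¹z) (reflexive (fun-inv z))) z≤fz

  module Orbits (f : Aut P) where
    open Aut f
    open Powers f
    open PosetProperties P using (<-respˡ-≈)
    open PartialOrderReasoning P

    ∼f-pow : ∀ n x → _∼f_ P f x (pow P f n x)
    ∼f-pow n x = n , n , refl , refl

    pow≤pow⇒pow-diff≤ : ∀ {x y} j k → pow P f j x ≤ pow P f k y → pow P f (- k + j) x ≤ y
    pow≤pow⇒pow-diff≤ {x} j k fʲx≤fᵏy =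
      trans (reflexive (Eq.sym (pow-+ (- k) j x))) (from (NegPowTranspose.≤-transpose k) fʲx≤fᵏy)

    pow-diff<⇒pow<pow : ∀ {x y} j k → _<_ P (pow P f (- k + j) x) y →
                        _<_ P (pow P f j x) (pow P f k y)
    pow-diff<⇒pow<pow {x} j k fᵈx<y =
      to (NegPowTranspose.<-transpose k) (<-respˡ-≈ (Eq.sym (pow-+ (- k) j x)) fᵈx<y)

    <ˢ⇔∀pow< : ∀ {x y} → _<ˢ_ P f x y ⇔ (∀ n → _<_ P (pow P f n x) y)
    <ˢ⇔∀pow< {x} {y} = mk⇔
      (λ x<ˢy n → x<ˢy _ _ (∼f-pow n x) (∼f-pow (+ 0) y))
      (λ fx<y x' y' (_ , j , _ , x'≤fʲx) (k , _ , fᵏy≤y' , _) → begin-strict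
         x'            ≤⟨ x'≤fʲx ⟩
         pow P f j x   <⟨ pow-diff<⇒pow<pow j k (fx<y (- k + j)) ⟩
         pow P f k y   ≤⟨ fᵏy≤y' ⟩
         y'            ∎)

    ≤ʷ⇔∃pow≤ : ∀ {x y} → _≤ʷ_ P f x y ⇔ Σ ℤ (λ n → pow P f n x ≤ y)
    ≤ʷ⇔∃pow≤ {x} {y} = mk⇔
      (λ (x' , y' , (i , _ , fⁱx≤x' , _) , (_ , l , _ , y'≤fˡy) , x'≤y') →
         - l + i , pow≤pow⇒pow-diff≤ i l (begin
           pow P f i x   ≤⟨ fⁱx≤x' ⟩
           x'            ≤⟨ x'≤y' ⟩
           y'            ≤⟨ y'≤fˡy ⟩
           pow P f l y   ∎))
      (λ (n , fⁿx≤y) → pow P f n x , y , ∼f-pow n x , ∼f-pow (+ 0) y , fⁿx≤y)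

    ∀pow<⇔∀<pow : ∀ {x y} → (∀ n → _<_ P (pow P f n x) y) ⇔ (∀ n → _<_ P x (pow P f n y))
    ∀pow<⇔∀<pow = mk⇔
      (λ fx<y n → to (NegPowTranspose.<-transpose n) (fx<y (- n)))
      (λ x<fy n → from (PowTranspose.<-transpose n) (x<fy (- n)))

    ∃pow≤⇔∃≤pow : ∀ {x y} → Σ ℤ (λ n → pow P f n x ≤ y) ⇔ Σ ℤ (λ n → x ≤ pow P f n y)
    ∃pow≤⇔∃≤pow = mk⇔
      (λ (n , fⁿx≤y) → - n , to (PowTranspose.≤-transpose n) fⁿx≤y)
      (λ (n , x≤fⁿy) → - n , from (NegPowTranspose.≤-transpose n) x≤fⁿy)

    -- If x ≈ f^n y while x ≤ f^(n±1) y, then f^n y is a fixed point of f, hence so is y, and x ≈ y.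
    ∀≤pow∧≉⇒∀≉pow : ∀ {x y} → (∀ n → x ≤ pow P f n y) → ¬ x ≈ y → ∀ n → ¬ x ≈ pow P f n y
    ∀≤pow∧≉⇒∀≉pow {x} {y} x≤fy x≉y n x≈fⁿy = x≉y (Eq.trans x≈fⁿy fⁿy≈y)
      where
      fⁿy≤f[fⁿy] : pow P f n y ≤ fun (pow P f n y)
      fⁿy≤f[fⁿy] = begin
        pow P f n y          ≈⟨ x≈fⁿy ⟨
        x                    ≤⟨ x≤fy (sucℤ n) ⟩
        pow P f (sucℤ n) y   ≈⟨ fun∘pow n y ⟨
        fun (pow P f n y)    ∎
      fⁿy≤f⁻¹[fⁿy] : pow P f n y ≤ inv (pow P f n y)
      fⁿy≤f⁻¹[fⁿy] = begin
        pow P f n y          ≈⟨ x≈fⁿy ⟨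
        x                    ≤⟨ x≤fy (pred n) ⟩
        pow P f (pred n) y   ≈⟨ inv∘pow n y ⟨
        inv (pow P f n y)    ∎
      fⁿy≈y : pow P f n y ≈ y
      fⁿy≈y = Eq.trans
        (Eq.sym (pow-fixed (≤fun∧≤inv⇒fixed fⁿy≤f[fⁿy] fⁿy≤f⁻¹[fⁿy]) (- n)))
        (pow-inverseˡ n y)

    ∀<pow⇔∀≤pow∧≉ : ∀ {x y} → (∀ n → _<_ P x (pow P f n y)) ⇔ ((∀ n → x ≤ pow P f n y) × ¬ x ≈ y)
    ∀<pow⇔∀≤pow∧≉ = mk⇔
      (λ x<fy → proj₁ ∘ x<fy , proj₂ (x<fy (+ 0)))
      (λ (x≤fy , x≉y) n → x≤fy n , ∀≤pow∧≉⇒∀≉pow x≤fy x≉y n)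

mainTheorem13 : {c ℓ₁ ℓ₂ : Level} (P : Poset c ℓ₁ ℓ₂) (f : Aut P) (x y : Poset.Carrier P) →
    ((_<ˢ_ P f x y ⇔ (∀ (n : ℤ) → _<_ P (pow P f n x) y))
      × (_<ˢ_ P f x y ⇔ (∀ (n : ℤ) → _<_ P x (pow P f n y)))
      × (_<ˢ_ P f x y ⇔ ((∀ (i : ℤ) → b P f i x y) × ¬ (Poset._≈_ P x y))))
    × ((_≤ʷ_ P f x y ⇔ Σ ℤ (λ n → Poset._≤_ P (pow P f n x) y))
      × (_≤ʷ_ P f x y ⇔ Σ ℤ (λ n → Poset._≤_ P x (pow P f n y)))
      × (_≤ʷ_ P f x y ⇔ Σ ℤ (λ i → b P f i x y)))
mainTheorem13 P f x y =
  ( <ˢ⇔∀pow<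
  , ⇔-trans <ˢ⇔∀pow< ∀pow<⇔∀<pow
  , ⇔-trans <ˢ⇔∀pow< (⇔-trans ∀pow<⇔∀<pow ∀<pow⇔∀≤pow∧≉) )
  , ( ≤ʷ⇔∃pow≤
  , ≤ʷ⇔∃≤pow
  , ≤ʷ⇔∃≤pow )
  where
  open Orbits P f
  ≤ʷ⇔∃≤pow : _≤ʷ_ P f x y ⇔ Σ ℤ (λ n → Poset._≤_ P x (pow P f n y))
  ≤ʷ⇔∃≤pow = ⇔-trans ≤ʷ⇔∃pow≤ ∃pow≤⇔∃≤pow
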